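{- Let $G$ be an $\alpha_1$-metric graph, let $u,v$ be vertices, and let $x,y\in S_k(u,v)$ be adjacent, for some $k$. Then $x$ and $y$ have a common neighbour in $S_{k-1}(u,v)$ and a common neighbour in $S_{k+1}(u,v)$.
   Context: All graphs are finite, undirected, unweighted, simple and connected; $d$ is the shortest-path distance, $I(u,v)=\{z : d(u,v)=d(u,z)+d(z,v)\}$, and for $0\le k\le d(u,v)$ the slice is $S_k(u,v)=\{x\in I(u,v): d(u,x)=k\}$. A graph is $\alpha_1$-metric if for all vertices $u,v,w,x$ with $v\in I(u,w)$, $w\in I(v,x)$ and $v,w$ adjacent, $d(u,x)\ge d(u,v)+d(v,x)-1$. (Note that adjacent $x,y\in S_k(u,v)$ forces $0<k<d(u,v)$.) -}

module Defs where

open import Data.Nat using (ℕ; zero; suc; _+_; _<_; _≤_)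
open import Data.Fin using (Fin)
open import Data.Product using (Σ; ∃; _×_; _,_)
open import Relation.Nullary using (¬_; Dec)
open import Relation.Binary.PropositionalEquality using (_≡_)

data Walk {V : Set} (Adj : V → V → Set) : V → V → ℕ → Set where
  nil  : ∀ {u} → Walk Adj u u 0
  cons : ∀ {u w v k} → Adj u w → Walk Adj w v k → Walk Adj u v (suc k)

record Graph : Set₁ where
  field
    n      : ℕ
    Adj    : Fin n → Fin n → Set
    adj?   : ∀ u v → Dec (Adj u v)
    irrefl : ∀ u → ¬ Adj u u
    sym    : ∀ {u v} → Adj u v → Adj v u

    connected : ∀ u v → ∃ λ k → Walk Adj u v k

  Walk′ : Fin n → Fin n → ℕ → Set
  Walk′ = Walk Adj

  Dist : Fin n → Fin n → ℕ → Set
  Dist u v k = Walk′ u v k × (∀ m → m < k → ¬ Walk′ u v m)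

  -- z ∈ S_k(u,v) :  z ∈ I(u,v) and d(u,z) = k
  InSlice : Fin n → Fin n → ℕ → Fin n → Set
  InSlice u v k z =
    Σ ℕ λ duv → Σ ℕ λ dzv →
      Dist u v duv × Dist u z k × Dist z v dzv × duv ≡ k + dzv

  InInterval : Fin n → Fin n → Fin n → Set
  InInterval u v z = ∃ λ k → InSlice u v k z

  -- α₁-metric: for v ∈ I(u,w), w ∈ I(v,x), v ~ w :
  --   d(u,x) ≥ d(u,v) + d(v,x) - 1, written  d(u,v) + d(v,x) ≤ d(u,x) + 1
  IsAlpha1Metric : Set
  IsAlpha1Metric =
    ∀ u v w x → InInterval u w v → InInterval v x w → Adj v w →
    ∀ duv dvx dux → Dist u v duv → Dist v x dvx → Dist u x dux →
    duv + dvx ≤ dux + 1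

{-# OPTIONS --safe #-}
-- The neighbours of u lying on (u,v)-geodesics form a clique: two of them at distance 2,
-- a and b, would violate the α₁ condition for a, u, b, v. For adjacent x, y ∈ S_{k+1}(u,v)
-- pick such neighbours a towards x and b towards y. If a is also one step closer to y
-- (or b to x), induct in S_k(a,v) (or S_k(b,v)). Otherwise a ≠ b forces a ~ b, and xy, ab
-- are opposite edges of a cycle of length 2k+2 ≥ 4, which the α₁ condition for
-- x, a, b, y forbids. Exchanging u and v turns lower common neighbours into upper ones.
module Submission where

open import Defs
open import Data.Nat using (ℕ; zero; suc; _+_; _∸_; _≤_; _<_; s≤s; _≟_)
open import Data.Nat.Induction using (<-rec)
open import Data.Nat.Properties
open import Data.Fin using (Fin)
open import Data.Fin.Properties using (any?) renaming (_≟_ to _≟ᶠ_)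
open import Data.Product using (∃; _×_; _,_; proj₁; proj₂; map₁; map₂)
open import Data.Empty using (⊥; ⊥-elim)
open import Data.Sum using (_⊎_; inj₁; inj₂)
open import Relation.Nullary using (¬_; Dec; yes; no)
open import Relation.Nullary.Decidable using (map′; _×-dec_)
open import Relation.Unary using (Pred; Decidable)
open import Relation.Binary.PropositionalEquality
  using (_≡_; _≢_; refl; sym; trans; cong; cong₂; subst; subst₂; ≢-sym; module ≡-Reasoning)

Least : ∀ {p} → Pred ℕ p → Pred ℕ p
Least P k = P k × (∀ j → j < k → ¬ P j)

least-witness : ∀ {p} {P : Pred ℕ p} → Decidable P → ∀ m → P m → ∃ (Least P)
least-witness {P = P} P? = <-rec (λ m → P m → ∃ (Least P)) search
  where
  search : ∀ m → (∀ {j} → j < m → P j → ∃ (Least P)) → P m → ∃ (Least P)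
  search m below Pm with anyUpTo? P? m
  ... | yes (j , j<m , Pj) = below j<m Pj
  ... | no none            = m , Pm , λ j j<m Pj → none (j , j<m , Pj)

least-unique : ∀ {p} {P : Pred ℕ p} {m n} → Least P m → Least P n → m ≡ n
least-unique (Pm , m-least) (Pn , n-least) =
  ≤-antisym (≮⇒≥ λ n<m → m-least _ n<m Pn) (≮⇒≥ λ m<n → n-least _ m<n Pm)

module Distance (G : Graph) where
  open Graph G renaming (sym to adj-sym)

  private
    V : Set
    V = Fin n

  walk? : ∀ m u v → Dec (Walk′ u v m)
  walk? zero    u v = map′ (λ { refl → nil }) (λ { nil → refl }) (u ≟ᶠ v)
  walk? (suc m) u v =
    map′ (λ (w , uw , p) → cons uw p) (λ { (cons uw p) → _ , uw , p })
         (any? λ w → adj? u w ×-dec walk? m w v)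

  _++_ : ∀ {u w v j k} → Walk′ u w j → Walk′ w v k → Walk′ u v (j + k)
  nil       ++ q = q
  cons uw p ++ q = cons uw (p ++ q)

  snoc : ∀ {u w v k} → Walk′ u w k → Adj w v → Walk′ u v (suc k)
  snoc nil        wv = cons wv nil
  snoc (cons e p) wv = cons e (snoc p wv)

  reverse : ∀ {u v k} → Walk′ u v k → Walk′ v u k
  reverse nil        = nil
  reverse (cons e p) = snoc (reverse p) (adj-sym e)

  walk₀⇒≡ : ∀ {u v} → Walk′ u v 0 → u ≡ v
  walk₀⇒≡ nil = refl

  d : V → V → ℕ
  d u v = proj₁ (least-witness (λ m → walk? m u v) _ (proj₂ (connected u v)))

  d-dist : ∀ u v → Dist u v (d u v)
  d-dist u v = proj₂ (least-witness (λ m → walk? m u v) _ (proj₂ (connected u v)))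

  dist⇒d≡ : ∀ {u v m} → Dist u v m → d u v ≡ m
  dist⇒d≡ = least-unique (d-dist _ _)

  d-minimal : ∀ {u v m} → Walk′ u v m → d u v ≤ m
  d-minimal {u} {v} {m} p = ≮⇒≥ λ m<d → proj₂ (d-dist u v) m m<d p

  d-sym : ∀ u v → d u v ≡ d v u
  d-sym u v = ≤-antisym (d-minimal (reverse (proj₁ (d-dist v u))))
                        (d-minimal (reverse (proj₁ (d-dist u v))))

  d-triangle : ∀ u w v → d u v ≤ d u w + d w v
  d-triangle u w v = d-minimal (proj₁ (d-dist u w) ++ proj₁ (d-dist w v))

  d-refl : ∀ u → d u u ≡ 0
  d-refl u = n≤0⇒n≡0 (d-minimal nil)

  d≡0⇒≡ : ∀ {u v} → d u v ≡ 0 → u ≡ v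
  d≡0⇒≡ {u} {v} eq = walk₀⇒≡ (subst (Walk′ u v) eq (proj₁ (d-dist u v)))

  adj⇒d≡1 : ∀ {u v} → Adj u v → d u v ≡ 1
  adj⇒d≡1 {u} uv = ≤-antisym (d-minimal (cons uv nil))
    (n≢0⇒n>0 λ eq → irrefl u (subst (Adj u) (sym (d≡0⇒≡ eq)) uv))

  d-neighbourˡ : ∀ {u a} v → Adj u a → d u v ≤ suc (d a v)
  d-neighbourˡ {u} {a} v ua = subst (λ t → d u v ≤ t + d a v) (adj⇒d≡1 ua) (d-triangle u a v)

  d-neighbourʳ : ∀ {v a} u → Adj v a → d u v ≤ suc (d u a)
  d-neighbourʳ {v} {a} u va = subst₂ (λ s t → s ≤ suc t) (d-sym v u) (d-sym a u) (d-neighbourˡ u va)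

  d≡suc⇒neighbour : ∀ {u v m} → d u v ≡ suc m → ∃ λ a → Adj u a × d a v ≡ m
  d≡suc⇒neighbour {u} {v} {m} eq with subst (Walk′ u v) eq (proj₁ (d-dist u v))
  ... | cons {w = a} ua p = a , ua , ≤-antisym (d-minimal p)
                                     (≤-pred (subst (_≤ suc (d a v)) eq (d-neighbourˡ v ua)))

  d≡1⇒adj : ∀ {u v} → d u v ≡ 1 → Adj u v
  d≡1⇒adj {u} eq with d≡suc⇒neighbour eq
  ... | a , ua , av = subst (Adj u) (d≡0⇒≡ av) ua

  d≡2 : ∀ {u a b} → Adj u a → Adj u b → a ≢ b → ¬ Adj a b → d a b ≡ 2
  d≡2 {u} {a} {b} ua ub a≢b ¬ab
    with d a b in eq | subst (λ t → d a b ≤ suc t) (adj⇒d≡1 ub) (d-neighbourˡ b (adj-sym ua))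
  ... | 0                 | _ = ⊥-elim (a≢b (d≡0⇒≡ eq))
  ... | 1                 | _ = ⊥-elim (¬ab (d≡1⇒adj eq))
  ... | 2                 | _ = refl
  ... | suc (suc (suc _)) | s≤s (s≤s ())

  Between : V → V → V → Set
  Between u z v = d u v ≡ d u z + d z v

  InSliceᵈ : V → V → ℕ → V → Set
  InSliceᵈ u v k z = d u z ≡ k × d u v ≡ k + d z v

  between⇒inInterval : ∀ {u z v} → Between u z v → InInterval u v z
  between⇒inInterval {u} {z} {v} uzv =
    d u z , d u v , d z v , d-dist u v , d-dist u z , d-dist z v , uzv

  inSlice⇒inSliceᵈ : ∀ {u v k z} → InSlice u v k z → InSliceᵈ u v k z
  inSlice⇒inSliceᵈ {k = k} (_ , _ , uv , uz , zv , eq) =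
    dist⇒d≡ uz , trans (dist⇒d≡ uv) (trans eq (cong (k +_) (sym (dist⇒d≡ zv))))

  inSliceᵈ⇒inSlice : ∀ {u v k z} → InSliceᵈ u v k z → InSlice u v k z
  inSliceᵈ⇒inSlice {u} {v} {k} {z} (uz , eq) =
    d u v , d z v , d-dist u v , subst (Dist u z) uz (d-dist u z) , d-dist z v , eq

  between-sym : ∀ {u z v} → Between u z v → Between v z u
  between-sym {u} {z} {v} uzv = begin
    d v u         ≡⟨ d-sym v u ⟩
    d u v         ≡⟨ uzv ⟩
    d u z + d z v ≡⟨ +-comm (d u z) (d z v) ⟩
    d z v + d u z ≡⟨ cong₂ _+_ (d-sym z v) (d-sym u z) ⟩
    d v z + d z u ∎
    where open ≡-Reasoning

  between-refineʳ : ∀ {u a z v} → Between u a v → Between a z v → Between u a z × Between u z v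
  between-refineʳ {u} {a} {z} {v} uav azv = uaz , uzv
    where
    path : d u v ≡ d u a + d a z + d z v
    path = trans uav (trans (cong (d u a +_) azv) (sym (+-assoc (d u a) (d a z) (d z v))))
    uzv : Between u z v
    uzv = ≤-antisym (d-triangle u z v)
                    (≤-trans (+-monoˡ-≤ (d z v) (d-triangle u a z)) (≤-reflexive (sym path)))
    uaz : Between u a z
    uaz = ≤-antisym (d-triangle u a z)
                    (+-cancelʳ-≤ (d z v) _ _ (≤-reflexive (trans (sym path) uzv)))

  between-refineˡ : ∀ {u a x v} → Between u a x → Between u x v → Between a x v × Between u a v
  between-refineˡ uax uxv with between-refineʳ (between-sym uxv) (between-sym uax)
  ... | vxa , vau = between-sym vxa , between-sym vau

  inSliceᵈ-start : ∀ {u v} → InSliceᵈ u v 0 u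
  inSliceᵈ-start {u} = d-refl u , refl

  slice-step : ∀ {u v k x} → InSliceᵈ u v (suc k) x →
               ∃ λ a → Adj u a × Between u a v × InSliceᵈ a v k x
  slice-step {u} {v} {k} {x} (ux , uv) with d≡suc⇒neighbour ux
  ... | a , ua , ax
    with between-refineˡ (trans ux (sym (cong₂ _+_ (adj⇒d≡1 ua) ax)))
                         (trans uv (cong (_+ d x v) (sym ux)))
  ...   | axv , uav = a , ua , uav , ax , trans axv (cong (_+ d x v) ax)

  slice-lift : ∀ {u a v k z} → Adj u a → Between u a v → InSliceᵈ a v k z → InSliceᵈ u v (suc k) z
  slice-lift {u} {a} {v} {k} {z} ua uav (az , av) =
    trans (proj₁ (between-refineʳ uav (trans av (cong (_+ d z v) (sym az)))))
          (cong₂ _+_ (adj⇒d≡1 ua) az) ,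
    trans uav (cong₂ _+_ (adj⇒d≡1 ua) av)

  slice-flip : ∀ {u v k m z} → InSliceᵈ u v k z → d u v ≡ k + m → InSliceᵈ v u m z
  slice-flip {u} {v} {k} {m} {z} (uz , uv) uv≡k+m = vz , (begin
      d v u         ≡⟨ d-sym v u ⟩
      d u v         ≡⟨ uv≡k+m ⟩
      k + m         ≡⟨ +-comm k m ⟩
      m + k         ≡⟨ cong (m +_) (trans (d-sym z u) uz) ⟨
      m + d z u     ∎)
    where
    open ≡-Reasoning
    vz : d v z ≡ m
    vz = trans (d-sym v z) (+-cancelˡ-≡ k _ _ (trans (sym uv) uv≡k+m))

  slice-far-distance : ∀ {u v k x y} → InSliceᵈ u v k x → InSliceᵈ u v k y → d x v ≡ d y v
  slice-far-distance {k = k} (_ , uv) (_ , uv′) = +-cancelˡ-≡ k _ _ (trans (sym uv) uv′)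

  ¬adj-in-slice₀ : ∀ {u v x y} → InSliceᵈ u v 0 x → InSliceᵈ u v 0 y → ¬ Adj x y
  ¬adj-in-slice₀ {u} (ux , _) (uy , _) xy =
    irrefl u (subst₂ Adj (sym (d≡0⇒≡ ux)) (sym (d≡0⇒≡ uy)) xy)

  d≢⇒d≡2+ : ∀ {u c x y j} → Adj u c → Adj x y → d u y ≡ 2 + j → d c x ≡ suc j →
             d c y ≢ suc j → d c y ≡ 2 + j
  d≢⇒d≡2+ {u} {c} {x} {y} {j} uc xy uy cx cy≢ = ≤-antisym
    (subst (λ t → d c y ≤ suc t) cx (d-neighbourʳ c (adj-sym xy)))
    (≤∧≢⇒< (≤-pred (subst (_≤ suc (d c y)) uy (d-neighbourˡ y uc))) (≢-sym cy≢))

  module Alpha1Metric (α₁ : IsAlpha1Metric) where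

    α₁-between : ∀ {u v w x} → Adj v w → Between u v w → Between v w x → d u v + d v x ≤ d u x + 1
    α₁-between {u} {v} {w} {x} vw uvw vwx =
      α₁ u v w x (between⇒inInterval uvw) (between⇒inInterval vwx) vw _ _ _
         (d-dist u v) (d-dist v x) (d-dist u x)

    interval-neighbours-clique : ∀ {u v a b} → Adj u a → Adj u b → Between u a v → Between u b v →
                                 a ≡ b ⊎ Adj a b
    interval-neighbours-clique {u} {v} {a} {b} ua ub uav ubv with a ≟ᶠ b | adj? a b
    ... | yes a≡b | _      = inj₁ a≡b
    ... | no _    | yes ab = inj₂ ab
    ... | no a≢b  | no ¬ab =
      ⊥-elim (n≮n (suc (d a v)) (subst (2 + d a v ≤_) (+-comm (d a v) 1) too-long))
      where
      aub : Between a u b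
      aub = trans (d≡2 ua ub a≢b ¬ab) (sym (cong₂ _+_ (adj⇒d≡1 (adj-sym ua)) (adj⇒d≡1 ub)))
      too-long : 2 + d a v ≤ d a v + 1
      too-long = subst₂ (λ s t → s + t ≤ d a v + 1) (adj⇒d≡1 (adj-sym ua))
                        (trans uav (cong (_+ d a v) (adj⇒d≡1 ua)))
                        (α₁-between ub aub ubv)

    no-opposite-edges : ∀ {x y a b m} → Adj x y → Adj a b →
                        d a x ≡ suc m → d b y ≡ suc m → d a y ≡ 2 + m → d b x ≡ 2 + m → ⊥
    no-opposite-edges {x} {y} {a} {b} {m} xy ab ax by ay bx = absurd bound
      where
      xa : d x a ≡ suc m
      xa = trans (d-sym x a) ax
      xab : Between x a b
      xab = trans (trans (d-sym x b) bx)
                  (sym (trans (cong₂ _+_ xa (adj⇒d≡1 ab)) (+-comm (suc m) 1)))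
      aby : Between a b y
      aby = trans ay (sym (cong₂ _+_ (adj⇒d≡1 ab) by))
      bound : suc m + (2 + m) ≤ 1 + 1
      bound = subst₂ (λ s t → s ≤ t + 1) (cong₂ _+_ xa ay) (adj⇒d≡1 xy) (α₁-between ab xab aby)
      absurd : ¬ suc m + (2 + m) ≤ 2
      absurd (s≤s le) with m+n≤o⇒n≤o m le
      ... | s≤s ()

    common-neighbour-below-suc : ∀ {u v x y} k → InSliceᵈ u v (suc k) x → InSliceᵈ u v (suc k) y →
                                 Adj x y → ∃ λ z → InSliceᵈ u v k z × Adj x z × Adj y z
    common-neighbour-below-suc zero (ux , _) (uy , _) xy =
      _ , inSliceᵈ-start , adj-sym (d≡1⇒adj ux) , adj-sym (d≡1⇒adj uy)
    common-neighbour-below-suc {u} {v} {x} {y} (suc j) sx sy xy =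
      from-first-steps (slice-step sx) (slice-step sy)
      where
      FirstStep : V → Set
      FirstStep w = ∃ λ a → Adj u a × Between u a v × InSliceᵈ a v (suc j) w

      via : ∀ {c} → Adj u c → Between u c v → InSliceᵈ c v (suc j) x → InSliceᵈ c v (suc j) y →
            ∃ λ z → InSliceᵈ u v (suc j) z × Adj x z × Adj y z
      via uc ucv cx cy with common-neighbour-below-suc j cx cy xy
      ... | z , cz , xz , yz = z , slice-lift uc ucv cz , xz , yz

      xv≡yv : d x v ≡ d y v
      xv≡yv = slice-far-distance sx sy

      from-first-steps : FirstStep x → FirstStep y →
                         ∃ λ z → InSliceᵈ u v (suc j) z × Adj x z × Adj y z
      from-first-steps (a , ua , uav , ax) (b , ub , ubv , by) with d a y ≟ suc j | d b x ≟ suc j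
      ... | yes ay | _      = via ua uav ax (ay , trans (proj₂ ax) (cong (suc j +_) xv≡yv))
      ... | no _   | yes bx = via ub ubv (bx , trans (proj₂ by) (cong (suc j +_) (sym xv≡yv))) by
      ... | no ay≢ | no bx≢ with interval-neighbours-clique ua ub uav ubv
      ...   | inj₁ refl = ⊥-elim (ay≢ (proj₁ by))
      ...   | inj₂ ab   = ⊥-elim (no-opposite-edges xy ab (proj₁ ax) (proj₁ by)
                            (d≢⇒d≡2+ ua xy (proj₁ sy) (proj₁ ax) ay≢)
                            (d≢⇒d≡2+ ub (adj-sym xy) (proj₁ sx) (proj₁ by) bx≢))

    common-neighbour-below : ∀ {u v x y} k → InSliceᵈ u v k x → InSliceᵈ u v k y → Adj x y →
                             ∃ λ z → InSliceᵈ u v (k ∸ 1) z × Adj x z × Adj y z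
    common-neighbour-below zero    sx sy xy = ⊥-elim (¬adj-in-slice₀ sx sy xy)
    common-neighbour-below (suc k) sx sy xy = common-neighbour-below-suc k sx sy xy

    common-neighbour-above : ∀ {u v x y} k → InSliceᵈ u v k x → InSliceᵈ u v k y → Adj x y →
                             ∃ λ z → InSliceᵈ u v (suc k) z × Adj x z × Adj y z
    common-neighbour-above {u} {v} {x} {y} k sx sy xy = towards-v (d x v) (proj₂ sx)
      where
      towards-v : ∀ m → d u v ≡ k + m → ∃ λ z → InSliceᵈ u v (suc k) z × Adj x z × Adj y z
      towards-v zero    uv = ⊥-elim (¬adj-in-slice₀ (slice-flip sx uv) (slice-flip sy uv) xy)
      towards-v (suc m) uv
        with common-neighbour-below-suc m (slice-flip sx uv) (slice-flip sy uv) xy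
      ... | z , vz , xz , yz = z , slice-flip vz vu , xz , yz
        where
        vu : d v u ≡ m + suc k
        vu = trans (d-sym v u) (trans uv (trans (+-comm k (suc m)) (sym (+-suc m k))))

corollary3 : (G : Graph) → Graph.IsAlpha1Metric G →
    ∀ u v x y (k : ℕ) →
    Graph.InSlice G u v k x → Graph.InSlice G u v k y → Graph.Adj G x y →
    (∃ λ z → Graph.InSlice G u v (k ∸ 1) z × Graph.Adj G x z × Graph.Adj G y z)
    × (∃ λ z → Graph.InSlice G u v (suc k) z × Graph.Adj G x z × Graph.Adj G y z)
corollary3 G α₁ u v x y k sx sy xy =
  in-slice (common-neighbour-below k sxᵈ syᵈ xy) , in-slice (common-neighbour-above k sxᵈ syᵈ xy)
  where
  open Graph G using (Adj; InSlice)
  open Distance G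
  open Alpha1Metric α₁

  sxᵈ : InSliceᵈ u v k x
  sxᵈ = inSlice⇒inSliceᵈ sx
  syᵈ : InSliceᵈ u v k y
  syᵈ = inSlice⇒inSliceᵈ sy

  in-slice : ∀ {j} → (∃ λ z → InSliceᵈ u v j z × Adj x z × Adj y z) →
             ∃ λ z → InSlice u v j z × Adj x z × Adj y z
  in-slice = map₂ (map₁ inSliceᵈ⇒inSlice)
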